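{- Fix an instance of Fully Online Matching and a rank vector $\mathbf{y}$. If $u$ is matched in $M(\mathbf{y})$, then the symmetric difference between $M(\mathbf{y})$ and $M(\mathbf{y}_{ -u})$ is an alternating path $(u_0,u_1,\ldots,u_l)$ with $u_0=u$ such that (1) for all even $i<l$, $(u_i,u_{i+1})\in M(\mathbf{y})$, and for all odd $i<l$, $(u_i,u_{i+1})\in M(\mathbf{y}_{ -u})$; (2) going from $M(\mathbf{y})$ to $M(\mathbf{y}_{ -u})$, the vertices $u_1,u_3,\ldots$ get worse and the vertices $u_2,u_4,\ldots$ get better.
   Context: Fully Online Matching: a graph $G=(V,E)$; events are arrivals and deadlines of vertices, each vertex's deadline occurring after the arrivals of itself and all its neighbours. $M(\mathbf{y})$ is the matching produced by Ranking with ranks $\mathbf{y}$: at the deadline of each unmatched vertex $w$, match $w$ to its unmatched neighbour of smallest rank, if any. $\mathbf{y}_{ -u}$ is $\mathbf{y}$ with the $u$-th entry removed and $M(\mathbf{y}_{ -u})$ is the matching produced by Ranking on $G-\{u\}$ (same event order, $u$ removed) with ranks $\mathbf{y}_{ -u}$. If edge $(a,b)$ is added at $a$'s deadline, $a$ is active and $b$ passive. The order "better" on a vertex's outcome: passive is better than active, which is better than unmatched; among passive outcomes, being matched to a vertex with an earlier deadline is better; among active outcomes, being matched to a vertex with smaller (higher-priority) rank is better. -}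

module Defs where

open import Data.Nat using (ℕ; zero; suc; _<_; _%_)
open import Data.Bool using (Bool; true; false; if_then_else_; _∧_; _∨_; not)
open import Data.Fin using (Fin; toℕ; inject₁) renaming (suc to fsuc; zero to fzero)
open import Data.Fin.Properties using (_≟_)
open import Data.List using (List; []; _∷_; _++_; foldl; foldr; filter; allFin)
open import Data.List.Membership.Propositional using (_∈_)
open import Data.List.Relation.Unary.Unique.Propositional using (Unique)
open import Data.Maybe using (Maybe; just; nothing)
open import Data.Product using (Σ; ∃; ∃-syntax; _×_; _,_)
open import Data.Sum using (_⊎_)
open import Relation.Nullary using (¬_; does)
open import Relation.Binary.PropositionalEquality using (_≡_; _≢_)
open import Function using (Injective)

data Event (n : ℕ) : Set where
  arrive   : Fin n → Event n
  deadline : Fin n → Event n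

Before : ∀ {n} → Event n → Event n → List (Event n) → Set
Before e₁ e₂ es = ∃[ xs ] ∃[ ys ] ∃[ zs ] (es ≡ xs ++ (e₁ ∷ ys ++ (e₂ ∷ zs)))

record Instance (n : ℕ) : Set where
  field
    adj        : Fin n → Fin n → Bool
    adj-sym    : ∀ a b → adj a b ≡ adj b a
    adj-irrefl : ∀ a → adj a a ≡ false
    events     : List (Event n)
    events-unique : Unique events
    arrives    : ∀ v → arrive v ∈ events
    dies       : ∀ v → deadline v ∈ events
    deadline-after-arrivals :
      ∀ v w → (w ≡ v ⊎ adj v w ≡ true) → Before (arrive w) (deadline v) events

-- Matchings produced by Ranking, recorded as a list of edges
-- (active , passive): the edge (a , b) was added at a's deadline.

Matching : ℕ → Set
Matching n = List (Fin n × Fin n)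

_=ᵇ_ : ∀ {n} → Fin n → Fin n → Bool
a =ᵇ b = does (a ≟ b)

isMatched : ∀ {n} → Matching n → Fin n → Bool
isMatched []             v = false
isMatched ((a , b) ∷ M)  v = (a =ᵇ v) ∨ (b =ᵇ v) ∨ isMatched M v

-- Ranks: y v is the rank of v (smaller = higher priority)
-- keep the candidate of smaller rank
minRank : ∀ {n} → (Fin n → ℕ) → Maybe (Fin n) → Fin n → Maybe (Fin n)
minRank y nothing  c = just c
minRank y (just b) c = if does (Data.Nat._<?_ (y c) (y b)) then just c else just b

pickNeighbour : ∀ {n} → (Fin n → Fin n → Bool) → (Fin n → ℕ) →
                Matching n → Fin n → Maybe (Fin n)
pickNeighbour {n} adj y M w =
  foldl (minRank y) nothing
        (filter (λ c → Data.Bool._≟_ (adj w c ∧ not (isMatched M c)) true) (allFin n))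

rankingStep : ∀ {n} → (Fin n → Fin n → Bool) → (Fin n → ℕ) →
              Matching n → Event n → Matching n
rankingStep adj y M (arrive v)   = M
rankingStep adj y M (deadline w) with isMatched M w
... | true  = M
... | false with pickNeighbour adj y M w
...   | nothing = M
...   | just c  = (w , c) ∷ M

rankingOn : ∀ {n} → (Fin n → Fin n → Bool) → List (Event n) → (Fin n → ℕ) → Matching n
rankingOn adj es y = foldl (rankingStep adj y) [] es

ranking : ∀ {n} → Instance n → (Fin n → ℕ) → Matching n
ranking I y = rankingOn (Instance.adj I) (Instance.events I) y

adjWithout : ∀ {n} → (Fin n → Fin n → Bool) → Fin n → Fin n → Fin n → Bool
adjWithout adj u a b = adj a b ∧ not (a =ᵇ u) ∧ not (b =ᵇ u)

notAbout : ∀ {n} → Fin n → Event n → Bool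
notAbout u (arrive v)   = not (v =ᵇ u)
notAbout u (deadline v) = not (v =ᵇ u)

eventsWithout : ∀ {n} → List (Event n) → Fin n → List (Event n)
eventsWithout es u = filter (λ e → Data.Bool._≟_ (notAbout u e) true) es

rankingWithout : ∀ {n} → Instance n → (Fin n → ℕ) → Fin n → Matching n
rankingWithout I y u =
  rankingOn (adjWithout (Instance.adj I) u) (eventsWithout (Instance.events I) u) y

EdgeIn : ∀ {n} → Matching n → Fin n → Fin n → Set
EdgeIn M a b = ((a , b) ∈ M) ⊎ ((b , a) ∈ M)

IsMatched : ∀ {n} → Matching n → Fin n → Set
IsMatched M v = ∃[ w ] EdgeIn M v w

data Outcome (n : ℕ) : Set where
  unmatched : Outcome n
  active    : Fin n → Outcome n   -- matched at own deadline to the given partner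
  passive   : Fin n → Outcome n   -- matched at the partner's deadline

outcome : ∀ {n} → Matching n → Fin n → Outcome n
outcome []            v = unmatched
outcome ((a , b) ∷ M) v with a =ᵇ v | b =ᵇ v
... | true  | _     = active b
... | false | true  = passive a
... | false | false = outcome M v

data Better {n} (I : Instance n) (y : Fin n → ℕ) : Outcome n → Outcome n → Set where
  pas>act : ∀ {a b} → Better I y (passive a) (active b)
  pas>un  : ∀ {a}   → Better I y (passive a) unmatched
  act>un  : ∀ {a}   → Better I y (active a) unmatched
  pas>pas : ∀ {a b} → Before (deadline a) (deadline b) (Instance.events I) →
            Better I y (passive a) (passive b)
  act>act : ∀ {a b} → y a < y b → Better I y (active a) (active b)

IsEven IsOdd : ℕ → Set
IsEven k = k % 2 ≡ 0
IsOdd  k = k % 2 ≡ 1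

SymDiff : ∀ {n} → Matching n → Matching n → Fin n → Fin n → Set
SymDiff M M' a b = (EdgeIn M a b × ¬ EdgeIn M' a b) ⊎ (EdgeIn M' a b × ¬ EdgeIn M a b)

PathEdgeAt : ∀ {n l} → (Fin (suc l) → Fin n) → Fin l → Fin n → Fin n → Set
PathEdgeAt p i a b = (p (inject₁ i) ≡ a × p (fsuc i) ≡ b) ⊎ (p (inject₁ i) ≡ b × p (fsuc i) ≡ a)

-- Ranking is run on G and on G − u side by side, one event at a time. Throughout, the two
-- current matchings differ exactly in the edges of an alternating path u = p₀, p₁, …, p_k, the
-- j-th edge lying in the run on G for even j and in the run on G − u for odd j, and the endpoint
-- p_k is still free in the run that would receive the next edge. At the deadline of a vertex w
-- off the path, w has the same free neighbours in both runs except p_k, which is free only in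
-- that run; as ranks are distinct, either both runs give w the same partner, or only one run
-- gives w the vertex p_k (the path grows by w), or that run gives w the vertex p_k while the
-- other gives w a vertex of larger rank (the path grows by w and that vertex). At the deadline
-- of p_k itself the path can only grow by p_k's new partner. A new endpoint is unmatched in the
-- run that would receive the next edge, and if that run matches it later the match is worse than
-- the one it already has: a passive partner whose deadline has passed loses to any later partner,
-- and an active endpoint whose neighbours in that run are all matched cannot be matched there.
module Submission where

open import Defs
open import Data.Bool using (Bool; true; false; _∧_; _∨_; not; if_then_else_)
import Data.Bool as Bool
open import Data.Bool.Properties
  using (∨-zeroʳ; ∨-conicalˡ; ∨-conicalʳ; ∧-conicalˡ; ∧-conicalʳ; ∧-zeroʳ; ∧-comm; ∧-identityʳ; not-injective; not-involutive)
open import Data.Empty using (⊥; ⊥-elim)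
open import Data.Fin using (Fin; toℕ; inject₁; fromℕ<; zero) renaming (suc to fsuc)
import Data.Fin.Properties as Fin
open import Data.List using (List; []; _∷_; _++_; [_]; foldl; filter; allFin)
open import Data.List.Properties using (++-assoc; ++-identityʳ)
open import Data.List.Membership.Propositional using (_∈_)
open import Data.List.Membership.Propositional.Properties
  using (∈-filter⁺; ∈-filter⁻; ∈-allFin; ∈-++⁺ˡ; ∈-++⁺ʳ; ∈-∃++)
open import Data.List.Relation.Unary.Any using (here; there)
open import Data.Maybe using (Maybe; just; nothing)
open import Data.Nat using (ℕ; zero; suc; _≤_; _<_; z≤n; s≤s; _<?_)
import Data.Nat as ℕ
open import Data.Nat.Properties
  using (≤-refl; ≤-trans; ≤-antisym; <⇒≤; <⇒≢; ≮⇒≥; ≤∧≢⇒<; m≤n⇒m<n∨m≡n; m≤n⇒m≤1+n; m<n⇒m<1+n; 1+n≰n; ≤-pred)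
open import Data.Product using (∃-syntax; _×_; _,_; proj₁; proj₂)
open import Data.Sum using (_⊎_; inj₁; inj₂; [_,_]′)
open import Function using (Injective; _∘_)
open import Relation.Binary.PropositionalEquality using (_≡_; _≢_; refl; sym; trans; cong; subst; subst₂)
open import Relation.Nullary using (¬_; Dec; does; yes; no)
open import Relation.Nullary.Decidable using (dec-true; dec-false)

true≢false : true ≢ false
true≢false ()

evenᵇ : ℕ → Bool
evenᵇ zero    = true
evenᵇ (suc j) = not (evenᵇ j)

IsEven⇒evenᵇ : ∀ j → IsEven j → evenᵇ j ≡ true
IsEven⇒evenᵇ zero          _    = refl
IsEven⇒evenᵇ (suc zero)    ()
IsEven⇒evenᵇ (suc (suc j)) even rewrite not-involutive (evenᵇ j) = IsEven⇒evenᵇ j even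

IsOdd⇒evenᵇ : ∀ j → IsOdd j → evenᵇ j ≡ false
IsOdd⇒evenᵇ zero          ()
IsOdd⇒evenᵇ (suc zero)    _   = refl
IsOdd⇒evenᵇ (suc (suc j)) odd rewrite not-involutive (evenᵇ j) = IsOdd⇒evenᵇ j odd

IsOdd⇒0< : ∀ j → IsOdd j → 0 < j
IsOdd⇒0< (suc j) _ = s≤s z≤n

evenᵇ-false⇒0< : ∀ {k} → evenᵇ k ≡ false → 0 < k
evenᵇ-false⇒0< {suc k} _ = s≤s z≤n

≡-or-≡not : ∀ b s → b ≡ s ⊎ b ≡ not s
≡-or-≡not true  true  = inj₁ refl
≡-or-≡not true  false = inj₂ refl
≡-or-≡not false true  = inj₂ refl
≡-or-≡not false false = inj₁ refl

module LeastRank {n : ℕ} (y : Fin n → ℕ) where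

  IsLeast : (Fin n → Set) → Maybe (Fin n) → Set
  IsLeast P nothing  = ∀ c → ¬ P c
  IsLeast P (just c) = P c × (∀ c′ → P c′ → y c ≤ y c′)

  IsLeast-cong : {P Q : Fin n → Set} → (∀ c → P c → Q c) → (∀ c → Q c → P c) →
                 ∀ r → IsLeast P r → IsLeast Q r
  IsLeast-cong P⇒Q Q⇒P nothing  least c Qc = least c (Q⇒P c Qc)
  IsLeast-cong P⇒Q Q⇒P (just c) (Pc , least) = P⇒Q c Pc , λ c′ Qc′ → least c′ (Q⇒P c′ Qc′)

  minRank-least : ∀ (P : Fin n → Set) acc x → IsLeast P acc →
                  IsLeast (λ c → P c ⊎ c ≡ x) (minRank y acc x)
  minRank-least P nothing  x least = inj₂ refl , λ { c (inj₁ Pc) → ⊥-elim (least c Pc) ; c (inj₂ refl) → ≤-refl }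
  minRank-least P (just b) x (Pb , least) = compare (y x <? y b)
    where
    compare : (x<b? : Dec (y x < y b)) →
              IsLeast (λ c → P c ⊎ c ≡ x) (if does x<b? then just x else just b)
    compare (yes x<b) = inj₂ refl , λ { c (inj₁ Pc) → ≤-trans (<⇒≤ x<b) (least c Pc) ; c (inj₂ refl) → ≤-refl }
    compare (no  x≮b) = inj₁ Pb , λ { c (inj₁ Pc) → least c Pc ; c (inj₂ refl) → ≮⇒≥ x≮b }

  foldl-minRank-least : ∀ (P : Fin n → Set) xs acc → IsLeast P acc →
                        IsLeast (λ c → P c ⊎ c ∈ xs) (foldl (minRank y) acc xs)
  foldl-minRank-least P []       acc least =
    IsLeast-cong (λ _ → inj₁) (λ { _ (inj₁ Pc) → Pc ; _ (inj₂ ()) }) acc least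
  foldl-minRank-least P (x ∷ xs) acc least =
    IsLeast-cong (λ { _ (inj₁ (inj₁ Pc))   → inj₁ Pc
                    ; _ (inj₁ (inj₂ refl)) → inj₂ (here refl)
                    ; _ (inj₂ c∈xs)        → inj₂ (there c∈xs) })
                 (λ { _ (inj₁ Pc)            → inj₁ (inj₁ Pc)
                    ; _ (inj₂ (here refl))   → inj₁ (inj₂ refl)
                    ; _ (inj₂ (there c∈xs)) → inj₂ c∈xs })
                 _ (foldl-minRank-least _ xs (minRank y acc x) (minRank-least P acc x least))

  -- pickNeighbour adj y M w unfolds to pickLeast (λ c → adj w c ∧ not (isMatched M c)).
  pickLeast : (Fin n → Bool) → Maybe (Fin n)
  pickLeast f = foldl (minRank y) nothing (filter (λ c → f c Bool.≟ true) (allFin n))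

  pickLeast-least : ∀ f → IsLeast (λ c → f c ≡ true) (pickLeast f)
  pickLeast-least f =
    IsLeast-cong (λ { c (inj₁ ()) ; c (inj₂ c∈) → proj₂ (∈-filter⁻ (λ c → f c Bool.≟ true) {xs = allFin n} c∈) })
                 (λ c fc → inj₂ (∈-filter⁺ (λ c → f c Bool.≟ true) (∈-allFin c) fc))
                 _ (foldl-minRank-least (λ _ → ⊥) _ nothing (λ _ ()))

  pickLeast-nothing : ∀ f → pickLeast f ≡ nothing → ∀ c → f c ≡ false
  pickLeast-nothing f none c with f c in fc | pickLeast f | pickLeast-least f
  ... | false | _      | _     = refl
  ... | true  | nothing | least = ⊥-elim (least c fc)
  pickLeast-nothing f () c | true | just _ | _

  pickLeast-just : ∀ f c → pickLeast f ≡ just c → f c ≡ true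
  pickLeast-just f c picked with pickLeast f | pickLeast-least f
  pickLeast-just f c refl | just .c | (fc , _) = fc

  data PickWithout (small large : Fin n → Bool) (x : Fin n) : Set where
    unchanged : pickLeast small ≡ pickLeast large → PickWithout small large x
    only-x    : pickLeast large ≡ just x → pickLeast small ≡ nothing → PickWithout small large x
    x-beats   : ∀ c → pickLeast large ≡ just x → pickLeast small ≡ just c → y x < y c →
                PickWithout small large x

  pickLeast-without : Injective _≡_ _≡_ y → ∀ small large x →
    (∀ c → small c ≡ true → large c ≡ true) → (∀ c → large c ≡ true → c ≢ x → small c ≡ true) →
    small x ≡ false → PickWithout small large x
  pickLeast-without y-inj small large x small⊆large large⊆small∪x x∉small =
    compare (pickLeast small) (pickLeast large) (pickLeast-least small) (pickLeast-least large) refl refl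
    where
    compare : ∀ s l → IsLeast (λ c → small c ≡ true) s → IsLeast (λ c → large c ≡ true) l →
              pickLeast small ≡ s → pickLeast large ≡ l → PickWithout small large x
    compare nothing  nothing  _ _ eqS eqL = unchanged (trans eqS (sym eqL))
    compare (just c) nothing  (sc , _) noneL _ _ = ⊥-elim (noneL c (small⊆large c sc))
    compare s (just c) leastS (lc , leastL) eqS eqL with c Fin.≟ x | s | leastS
    ... | yes refl | nothing  | _ = only-x eqL eqS
    ... | yes refl | just c′ | (sc′ , _) =
      x-beats c′ eqL eqS (≤∧≢⇒< (leastL c′ (small⊆large c′ sc′)) λ yx≡yc′ → x≢c′ (y-inj yx≡yc′))
      where
      x≢c′ : x ≢ c′
      x≢c′ refl = true≢false (trans (sym sc′) x∉small)
    ... | no c≢x | nothing  | noneS = ⊥-elim (noneS c (large⊆small∪x c lc c≢x))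
    ... | no c≢x | just c′ | (sc′ , leastS′) = unchanged (trans eqS (trans (cong just c′≡c) (sym eqL)))
      where
      c′≡c : c′ ≡ c
      c′≡c = y-inj (≤-antisym (leastS′ c (large⊆small∪x c lc c≢x)) (leastL c′ (small⊆large c′ sc′)))

module _ {n : ℕ} where

  SamePair : Fin n → Fin n → Fin n → Fin n → Set
  SamePair x z a c = (x ≡ a × z ≡ c) ⊎ (x ≡ c × z ≡ a)

  SamePair-sym : ∀ {x z a c} → SamePair x z a c → SamePair a c x z
  SamePair-sym (inj₁ (refl , refl)) = inj₁ (refl , refl)
  SamePair-sym (inj₂ (refl , refl)) = inj₂ (refl , refl)

  SamePair-trans : ∀ {x z a c x′ z′} → SamePair x z a c → SamePair a c x′ z′ → SamePair x z x′ z′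
  SamePair-trans (inj₁ (refl , refl)) q = q
  SamePair-trans (inj₂ (refl , refl)) (inj₁ (refl , refl)) = inj₂ (refl , refl)
  SamePair-trans (inj₂ (refl , refl)) (inj₂ (refl , refl)) = inj₁ (refl , refl)

  SamePair-apart : ∀ {x z a c v} → SamePair x z a c → a ≢ v → c ≢ v → x ≢ v × z ≢ v
  SamePair-apart (inj₁ (refl , refl)) a≢v c≢v = a≢v , c≢v
  SamePair-apart (inj₂ (refl , refl)) a≢v c≢v = c≢v , a≢v

  =ᵇ-refl : ∀ (a : Fin n) → (a =ᵇ a) ≡ true
  =ᵇ-refl a = dec-true (a Fin.≟ a) refl

  =ᵇ-≢ : ∀ {a b : Fin n} → a ≢ b → (a =ᵇ b) ≡ false
  =ᵇ-≢ {a} {b} a≢b = dec-false (a Fin.≟ b) a≢b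

  isMatched-∷⁺ : ∀ {M : Matching n} {v} a b → isMatched M v ≡ true → isMatched ((a , b) ∷ M) v ≡ true
  isMatched-∷⁺ {v = v} a b matched rewrite matched | ∨-zeroʳ (b =ᵇ v) = ∨-zeroʳ (a =ᵇ v)

  isMatched-∷-apart : ∀ {M : Matching n} {a b v} → a ≢ v → b ≢ v →
                      isMatched ((a , b) ∷ M) v ≡ isMatched M v
  isMatched-∷-apart a≢v b≢v rewrite =ᵇ-≢ a≢v | =ᵇ-≢ b≢v = refl

  isMatched-∷ˡ : ∀ {M : Matching n} a b → isMatched ((a , b) ∷ M) a ≡ true
  isMatched-∷ˡ a b rewrite =ᵇ-refl a = refl

  isMatched-∷ʳ : ∀ {M : Matching n} a b → isMatched ((a , b) ∷ M) b ≡ true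
  isMatched-∷ʳ {M} a b rewrite =ᵇ-refl b = ∨-zeroʳ (a =ᵇ b)

  ∈⇒isMatched : ∀ {M : Matching n} {a b} → (a , b) ∈ M → isMatched M a ≡ true × isMatched M b ≡ true
  ∈⇒isMatched {(a , b) ∷ M} (here refl) = isMatched-∷ˡ {M} a b , isMatched-∷ʳ {M} a b
  ∈⇒isMatched {(a , b) ∷ M} (there xz∈M) =
    isMatched-∷⁺ {M} a b (proj₁ (∈⇒isMatched xz∈M)) , isMatched-∷⁺ {M} a b (proj₂ (∈⇒isMatched xz∈M))

  EdgeIn-sym : ∀ {M : Matching n} {a b} → EdgeIn M a b → EdgeIn M b a
  EdgeIn-sym (inj₁ ab∈M) = inj₂ ab∈M
  EdgeIn-sym (inj₂ ba∈M) = inj₁ ba∈M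

  EdgeIn⇒isMatchedˡ : ∀ {M : Matching n} {a b} → EdgeIn M a b → isMatched M a ≡ true
  EdgeIn⇒isMatchedˡ (inj₁ ab∈M) = proj₁ (∈⇒isMatched ab∈M)
  EdgeIn⇒isMatchedˡ (inj₂ ba∈M) = proj₂ (∈⇒isMatched ba∈M)

  EdgeIn⇒isMatchedʳ : ∀ {M : Matching n} {a b} → EdgeIn M a b → isMatched M b ≡ true
  EdgeIn⇒isMatchedʳ = EdgeIn⇒isMatchedˡ ∘ EdgeIn-sym

  EdgeIn-SamePair : ∀ {M : Matching n} {x z a c} → SamePair x z a c → EdgeIn M x z → EdgeIn M a c
  EdgeIn-SamePair (inj₁ (refl , refl)) e = e
  EdgeIn-SamePair (inj₂ (refl , refl)) e = EdgeIn-sym e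

  EdgeIn-∷⁺ : ∀ {M : Matching n} {a b} e → EdgeIn M a b → EdgeIn (e ∷ M) a b
  EdgeIn-∷⁺ e (inj₁ ab∈M) = inj₁ (there ab∈M)
  EdgeIn-∷⁺ e (inj₂ ba∈M) = inj₂ (there ba∈M)

  EdgeIn-∷-here : ∀ {M : Matching n} {a b x z} → SamePair a b x z → EdgeIn ((a , b) ∷ M) x z
  EdgeIn-∷-here (inj₁ (refl , refl)) = inj₁ (here refl)
  EdgeIn-∷-here (inj₂ (refl , refl)) = inj₂ (here refl)

  EdgeIn-∷⁻ : ∀ {M : Matching n} {a b x z} → EdgeIn ((a , b) ∷ M) x z → SamePair a b x z ⊎ EdgeIn M x z
  EdgeIn-∷⁻ (inj₁ (here refl))    = inj₁ (inj₁ (refl , refl))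
  EdgeIn-∷⁻ (inj₁ (there xz∈M)) = inj₂ (inj₁ xz∈M)
  EdgeIn-∷⁻ (inj₂ (here refl))    = inj₁ (inj₂ (refl , refl))
  EdgeIn-∷⁻ (inj₂ (there zx∈M)) = inj₂ (inj₂ zx∈M)

  outcome-∷-apart : ∀ {M : Matching n} {a b v} → a ≢ v → b ≢ v → outcome ((a , b) ∷ M) v ≡ outcome M v
  outcome-∷-apart a≢v b≢v rewrite =ᵇ-≢ a≢v | =ᵇ-≢ b≢v = refl

  outcome-∷-active : ∀ {M : Matching n} a b → outcome ((a , b) ∷ M) a ≡ active b
  outcome-∷-active a b rewrite =ᵇ-refl a = refl

  outcome-∷-passive : ∀ {M : Matching n} {a} b → a ≢ b → outcome ((a , b) ∷ M) b ≡ passive a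
  outcome-∷-passive b a≢b rewrite =ᵇ-≢ a≢b | =ᵇ-refl b = refl

  outcome-unmatched : ∀ (M : Matching n) v → isMatched M v ≡ false → outcome M v ≡ unmatched
  outcome-unmatched []            v _ = refl
  outcome-unmatched ((a , b) ∷ M) v unmatched′
    rewrite ∨-conicalˡ (a =ᵇ v) _ unmatched′ | ∨-conicalˡ (b =ᵇ v) _ (∨-conicalʳ (a =ᵇ v) _ unmatched′)
    = outcome-unmatched M v (∨-conicalʳ (b =ᵇ v) _ (∨-conicalʳ (a =ᵇ v) _ unmatched′))

  addTo : Bool → Fin n × Fin n → (Bool → Matching n) → Bool → Matching n
  addTo true  e R true  = e ∷ R true
  addTo true  e R false = R false
  addTo false e R true  = R true
  addTo false e R false = e ∷ R false

  addTo-same : ∀ s e R → addTo s e R s ≡ e ∷ R s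
  addTo-same true  e R = refl
  addTo-same false e R = refl

  addTo-other : ∀ s e R → addTo s e R (not s) ≡ R (not s)
  addTo-other true  e R = refl
  addTo-other false e R = refl

  addTo-not : ∀ s e R → addTo (not s) e R s ≡ R s
  addTo-not true  e R = refl
  addTo-not false e R = refl

  addTo-cases : ∀ s e R b → (b ≡ s × addTo s e R b ≡ e ∷ R b) ⊎ (b ≡ not s × addTo s e R b ≡ R b)
  addTo-cases s e R b with ≡-or-≡not b s
  ... | inj₁ refl = inj₁ (refl , addTo-same s e R)
  ... | inj₂ refl = inj₂ (refl , addTo-other s e R)

  addTo-isMatched-apart : ∀ s {a c x z v} R b → SamePair a c x z → x ≢ v → z ≢ v →
                          isMatched (addTo s (a , c) R b) v ≡ isMatched (R b) v
  addTo-isMatched-apart s {a} {c} R b ac≐xz x≢v z≢v with addTo-cases s (a , c) R b | SamePair-apart ac≐xz x≢v z≢v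
  ... | inj₁ (_ , eq) | a≢v , c≢v rewrite eq = isMatched-∷-apart {M = R b} a≢v c≢v
  ... | inj₂ (_ , eq) | _ rewrite eq = refl

  addTo-outcome-apart : ∀ s {a c x z v} R b → SamePair a c x z → x ≢ v → z ≢ v →
                        outcome (addTo s (a , c) R b) v ≡ outcome (R b) v
  addTo-outcome-apart s {a} {c} R b ac≐xz x≢v z≢v with addTo-cases s (a , c) R b | SamePair-apart ac≐xz x≢v z≢v
  ... | inj₁ (_ , eq) | a≢v , c≢v rewrite eq = outcome-∷-apart {M = R b} a≢v c≢v
  ... | inj₂ (_ , eq) | _ rewrite eq = refl

  addTo-EdgeIn⁺ : ∀ s e R b {x z} → EdgeIn (R b) x z → EdgeIn (addTo s e R b) x z
  addTo-EdgeIn⁺ s e R b xz∈R with addTo-cases s e R b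
  ... | inj₁ (_ , eq) rewrite eq = EdgeIn-∷⁺ e xz∈R
  ... | inj₂ (_ , eq) rewrite eq = xz∈R

  addTo-EdgeIn⁻ : ∀ s {a c} R b {x z} → EdgeIn (addTo s (a , c) R b) x z →
                  (b ≡ s × SamePair a c x z) ⊎ EdgeIn (R b) x z
  addTo-EdgeIn⁻ s {a} {c} R b xz∈R′ with addTo-cases s (a , c) R b
  ... | inj₂ (_ , eq) rewrite eq = inj₂ xz∈R′
  ... | inj₁ (b≡s , eq) rewrite eq with EdgeIn-∷⁻ {M = R b} xz∈R′
  ...   | inj₁ ac≐xz = inj₁ (b≡s , ac≐xz)
  ...   | inj₂ xz∈R  = inj₂ xz∈R

  OffPath : (ℕ → Fin n) → ℕ → Fin n → Set
  OffPath p k v = ∀ j → j ≤ k → p j ≢ v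

  extendPath : (ℕ → Fin n) → ℕ → Fin n → ℕ → Fin n
  extendPath p k z j with j ℕ.≟ suc k
  ... | yes _ = z
  ... | no  _ = p j

  extendPath-≤ : ∀ p k z {j} → j ≤ k → extendPath p k z j ≡ p j
  extendPath-≤ p k z {j} j≤k with j ℕ.≟ suc k
  ... | yes refl = ⊥-elim (1+n≰n j≤k)
  ... | no  _    = refl

  extendPath-new : ∀ p k z → extendPath p k z (suc k) ≡ z
  extendPath-new p k z with suc k ℕ.≟ suc k
  ... | yes _  = refl
  ... | no  ne = ⊥-elim (ne refl)

  extendPath-split : ∀ p k z {j} → j ≤ suc k →
                     (j ≤ k × extendPath p k z j ≡ p j) ⊎ (j ≡ suc k × extendPath p k z j ≡ z)
  extendPath-split p k z j≤1+k with m≤n⇒m<n∨m≡n j≤1+k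
  ... | inj₁ (s≤s j≤k) = inj₁ (j≤k , extendPath-≤ p k z j≤k)
  ... | inj₂ refl      = inj₂ (refl , extendPath-new p k z)

  OffPath-extend : ∀ {p k z v} → OffPath p k v → z ≢ v → OffPath (extendPath p k z) (suc k) v
  OffPath-extend {p} {k} {z} off z≢v j j≤1+k with extendPath-split p k z j≤1+k
  ... | inj₁ (j≤k , eq) = λ pj≡v → off j j≤k (trans (sym eq) pj≡v)
  ... | inj₂ (_ , eq)   = λ zj≡v → z≢v (trans (sym eq) zj≡v)

  OffPath-extend⁻ : ∀ {p k z v} → OffPath (extendPath p k z) (suc k) v → OffPath p k v × z ≢ v
  OffPath-extend⁻ {p} {k} {z} off =
    (λ j j≤k pj≡v → off j (m≤n⇒m≤1+n j≤k) (trans (extendPath-≤ p k z j≤k) pj≡v)) ,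
    (λ z≡v → off (suc k) ≤-refl (trans (extendPath-new p k z) z≡v))

module _ {n : ℕ} (adj′ : Fin n → Fin n → Bool) (y : Fin n → ℕ) where
  open LeastRank y

  rankingStep-matched : ∀ M w → isMatched M w ≡ true → rankingStep adj′ y M (deadline w) ≡ M
  rankingStep-matched M w matched rewrite matched = refl

  rankingStep-none : ∀ M w → isMatched M w ≡ false →
                     pickLeast (λ c → adj′ w c ∧ not (isMatched M c)) ≡ nothing →
                     rankingStep adj′ y M (deadline w) ≡ M
  rankingStep-none M w free none rewrite free | none = refl

  rankingStep-pick : ∀ M w c → isMatched M w ≡ false →
                     pickLeast (λ c → adj′ w c ∧ not (isMatched M c)) ≡ just c →
                     rankingStep adj′ y M (deadline w) ≡ (w , c) ∷ M
  rankingStep-pick M w c free picked rewrite free | picked = refl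

module TwoRuns {n : ℕ} (I : Instance n) (y : Fin n → ℕ) (y-injective : Injective _≡_ _≡_ y) (u : Fin n) where
  open Instance I
  open LeastRank y

  -- Side true is the run of Ranking on G, side false the run on G − u; a pair of runs is
  -- R : Bool → Matching n.
  adjOn : Bool → Fin n → Fin n → Bool
  adjOn true  = adj
  adjOn false = adjWithout adj u

  available : Bool → Matching n → Fin n → Fin n → Bool
  available b M w c = adjOn b w c ∧ not (isMatched M c)

  runStep : Bool → Matching n → Event n → Matching n
  runStep true  M e = rankingStep adj y M e
  runStep false M e = if notAbout u e then rankingStep (adjWithout adj u) y M e else M

  adjOn-irrefl : ∀ b a → adjOn b a a ≡ false
  adjOn-irrefl true  a = adj-irrefl a
  adjOn-irrefl false a rewrite adj-irrefl a = refl

  adjOn-sym : ∀ b a c → adjOn b a c ≡ adjOn b c a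
  adjOn-sym true  a c = adj-sym a c
  adjOn-sym false a c rewrite adj-sym a c = cong (adj c a ∧_) (∧-comm (not (a =ᵇ u)) (not (c =ᵇ u)))

  adjOn-u : ∀ w → adjOn false w u ≡ false
  adjOn-u w rewrite =ᵇ-refl u | ∧-zeroʳ (not (w =ᵇ u)) = ∧-zeroʳ (adj w u)

  adjOn-agree : ∀ {w c} → w ≢ u → c ≢ u → adjOn true w c ≡ adjOn false w c
  adjOn-agree {w} {c} w≢u c≢u rewrite =ᵇ-≢ w≢u | =ᵇ-≢ c≢u = sym (∧-identityʳ (adj w c))

  available-matched : ∀ b M w c → isMatched M c ≡ true → available b M w c ≡ false
  available-matched b M w c matched rewrite matched = ∧-zeroʳ (adjOn b w c)

  available⇒adj : ∀ b M w c → available b M w c ≡ true → adjOn b w c ≡ true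
  available⇒adj b M w c avail = ∧-conicalˡ _ _ avail

  available⇒unmatched : ∀ b M w c → available b M w c ≡ true → isMatched M c ≡ false
  available⇒unmatched b M w c avail = not-injective (∧-conicalʳ (adjOn b w c) _ avail)

  available⇒≢ : ∀ b M w c → available b M w c ≡ true → w ≢ c
  available⇒≢ b M w c avail refl = true≢false (trans (sym (available⇒adj b M w w avail)) (adjOn-irrefl b w))

  unavailable-neighbour-matched : ∀ b M w c → available b M w c ≡ false → adjOn b w c ≡ true → isMatched M c ≡ true
  unavailable-neighbour-matched b M w c unavail adjacent rewrite adjacent with isMatched M c
  ... | true = refl
  unavailable-neighbour-matched b M w c () adjacent | false

  runStep-arrive : ∀ b M v → runStep b M (arrive v) ≡ M
  runStep-arrive true  M v = refl
  runStep-arrive false M v with notAbout u (arrive v)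
  ... | true  = refl
  ... | false = refl

  runStep-deadline-u : ∀ M → runStep false M (deadline u) ≡ M
  runStep-deadline-u M rewrite =ᵇ-refl u = refl

  runStep-deadline : ∀ b M {w} → w ≢ u → runStep b M (deadline w) ≡ rankingStep (adjOn b) y M (deadline w)
  runStep-deadline true  M w≢u = refl
  runStep-deadline false M w≢u rewrite =ᵇ-≢ w≢u = refl

  runStep-matched : ∀ b M {w} → w ≢ u → isMatched M w ≡ true → runStep b M (deadline w) ≡ M
  runStep-matched b M w≢u matched = trans (runStep-deadline b M w≢u) (rankingStep-matched (adjOn b) y M _ matched)

  runStep-none : ∀ b M {w} → w ≢ u → isMatched M w ≡ false → pickLeast (available b M w) ≡ nothing →
                 runStep b M (deadline w) ≡ M
  runStep-none b M w≢u free none = trans (runStep-deadline b M w≢u) (rankingStep-none (adjOn b) y M _ free none)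

  runStep-pick : ∀ b M {w} c → w ≢ u → isMatched M w ≡ false → pickLeast (available b M w) ≡ just c →
                 runStep b M (deadline w) ≡ (w , c) ∷ M
  runStep-pick b M c w≢u free picked =
    trans (runStep-deadline b M w≢u) (rankingStep-pick (adjOn b) y M _ c free picked)

  runs-without-u : ∀ M e es → foldl (rankingStep (adjWithout adj u) y) (runStep false M e) (eventsWithout es u)
                              ≡ foldl (rankingStep (adjWithout adj u) y) M (eventsWithout (e ∷ es) u)
  runs-without-u M e es with notAbout u e
  ... | true  = refl
  ... | false = refl

  -- Only p 0, …, p k matter; p j for j > k is junk.
  record AlternatingPath (R : Bool → Matching n) (k : ℕ) (p : ℕ → Fin n) : Set where
    field
      u-unmatched-without : isMatched (R false) u ≡ false
      starts-at-u         : p 0 ≡ u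
      distinct            : ∀ i j → i ≤ k → j ≤ k → p i ≡ p j → i ≡ j
      path-edge           : ∀ j → j < k →
                            EdgeIn (R (evenᵇ j)) (p j) (p (suc j)) × ¬ EdgeIn (R (not (evenᵇ j))) (p j) (p (suc j))
      shared-or-on-path   : ∀ b a c → EdgeIn (R b) a c →
                            EdgeIn (R (not b)) a c ⊎ ∃[ j ] (j < k × evenᵇ j ≡ b × SamePair (p j) (p (suc j)) a c)
      agree-off-path      : ∀ v → OffPath p k v → isMatched (R true) v ≡ isMatched (R false) v
      end-unmatched       : isMatched (R (evenᵇ k)) (p k) ≡ false
      inner-improves      : ∀ j → 0 < j → j < k →
                            Better I y (outcome (R (not (evenᵇ j))) (p j)) (outcome (R (evenᵇ j)) (p j))

  locate : ∀ (p : ℕ → Fin n) k w → (∃[ j ] (j ≤ k × p j ≡ w)) ⊎ OffPath p k w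
  locate p zero w with p 0 Fin.≟ w
  ... | yes p0≡w = inj₁ (0 , z≤n , p0≡w)
  ... | no  p0≢w = inj₂ λ { .0 z≤n → p0≢w }
  locate p (suc k) w with locate p k w
  ... | inj₁ (j , j≤k , pj≡w) = inj₁ (j , m≤n⇒m≤1+n j≤k , pj≡w)
  ... | inj₂ off with p (suc k) Fin.≟ w
  ...   | yes p1+k≡w = inj₁ (suc k , ≤-refl , p1+k≡w)
  ...   | no  p1+k≢w = inj₂ λ j j≤1+k → [ (λ { (s≤s j≤k) → off j j≤k }) , (λ { refl → p1+k≢w }) ]′ (m≤n⇒m<n∨m≡n j≤1+k)

  module AlternatingPathProperties {R k p} (path : AlternatingPath R k p) where
    open AlternatingPath path

    end≢u : 0 < k → p k ≢ u
    end≢u 0<k pk≡u with distinct k 0 ≤-refl z≤n (trans pk≡u (sym starts-at-u))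
    end≢u () _ | refl

    inner≢end : ∀ {j} → j < k → p j ≢ p k
    inner≢end j<k pj≡pk = <⇒≢ j<k (distinct _ _ (<⇒≤ j<k) ≤-refl pj≡pk)

    ≢u⇒0< : ∀ j → p j ≢ u → 0 < j
    ≢u⇒0< zero    p0≢u = ⊥-elim (p0≢u starts-at-u)
    ≢u⇒0< (suc j) _    = s≤s z≤n

    off-path≢u : ∀ {v} → OffPath p k v → v ≢ u
    off-path≢u off v≡u = off 0 z≤n (trans starts-at-u (sym v≡u))

    unmatched-off-path : ∀ {v} → OffPath p k v → ∀ b → isMatched (R b) v ≡ false → ∀ b′ → isMatched (R b′) v ≡ false
    unmatched-off-path off true  free true  = free
    unmatched-off-path off true  free false = trans (sym (agree-off-path _ off)) free
    unmatched-off-path off false free true  = trans (agree-off-path _ off) free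
    unmatched-off-path off false free false = free

    matched-inner : ∀ j → 0 < j → j < k → ∀ b → isMatched (R b) (p j) ≡ true
    matched-inner (suc i) _ 1+i<k b with ≡-or-≡not b (evenᵇ i)
    ... | inj₁ refl = EdgeIn⇒isMatchedʳ (proj₁ (path-edge i (<⇒≤ 1+i<k)))
    ... | inj₂ refl = EdgeIn⇒isMatchedˡ (proj₁ (path-edge (suc i) 1+i<k))

    u-matched-with : 0 < k → isMatched (R true) u ≡ true
    u-matched-with 0<k = subst (λ v → isMatched (R true) v ≡ true) starts-at-u (EdgeIn⇒isMatchedˡ (proj₁ (path-edge 0 0<k)))

    inner-unavailable : ∀ b w j → j < k → available b (R b) w (p j) ≡ false
    inner-unavailable true  w zero    0<k =
      available-matched true (R true) w (p 0) (subst (λ v → isMatched (R true) v ≡ true) (sym starts-at-u) (u-matched-with 0<k))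
    inner-unavailable false w zero    _   rewrite starts-at-u | adjOn-u w = refl
    inner-unavailable b     w (suc i) 1+i<k = available-matched b (R b) w (p (suc i)) (matched-inner (suc i) (s≤s z≤n) 1+i<k b)

    available⇒not-inner : ∀ b w {c} → available b (R b) w c ≡ true → ∀ {j} → j < k → p j ≢ c
    available⇒not-inner b w {c} avail {j} j<k pj≡c =
      true≢false (trans (sym avail) (subst (λ v → available b (R b) w v ≡ false) pj≡c (inner-unavailable b w j j<k)))

    available-off-path : ∀ {w c} → OffPath p k w → OffPath p k c → ∀ b b′ → available b (R b) w c ≡ available b′ (R b′) w c
    available-off-path {w} {c} w-off c-off b b′ = trans (toWith b) (sym (toWith b′))
      where
      toWith : ∀ b → available b (R b) w c ≡ available true (R true) w c
      toWith true  = refl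
      toWith false rewrite sym (adjOn-agree (off-path≢u w-off) (off-path≢u c-off)) | agree-off-path c c-off = refl

  end-matched-other : ∀ {R k p} → AlternatingPath R k p → 0 < k → isMatched (R (not (evenᵇ k))) (p k) ≡ true
  end-matched-other {k = suc i} path _ rewrite not-involutive (evenᵇ i) =
    EdgeIn⇒isMatchedʳ (proj₁ (AlternatingPath.path-edge path i ≤-refl))

  end≢u⇒0< : ∀ {R k p} → AlternatingPath R k p → p k ≢ u → 0 < k
  end≢u⇒0< {k = zero}  path pk≢u = ⊥-elim (pk≢u (AlternatingPath.starts-at-u path))
  end≢u⇒0< {k = suc _} path pk≢u = s≤s z≤n

  end-unavailable-other : ∀ {R k p} → AlternatingPath R k p → ∀ w → available (not (evenᵇ k)) (R (not (evenᵇ k))) w (p k) ≡ false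
  end-unavailable-other {k = zero}  path w rewrite AlternatingPath.starts-at-u path | adjOn-u w = refl
  end-unavailable-other {R} {suc i} {p} path w =
    available-matched (not (evenᵇ (suc i))) (R (not (evenᵇ (suc i)))) w (p (suc i)) (end-matched-other path (s≤s z≤n))

  EndImproves : (Bool → Matching n) → ℕ → (ℕ → Fin n) → Fin n × Fin n → Set
  EndImproves R k p e = 0 < k → Better I y (outcome (R (not (evenᵇ k))) (p k)) (outcome (e ∷ R (evenᵇ k)) (p k))

  module Extend {R k p} (path : AlternatingPath R k p) {a c z} (ac≐kz : SamePair a c (p k) z)
                (z-off : OffPath p k z) (z-free : isMatched (R true) z ≡ false) where
    open AlternatingPath path
    open AlternatingPathProperties path

    R′ : Bool → Matching n
    R′ = addTo (evenᵇ k) (a , c) R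

    p′ : ℕ → Fin n
    p′ = extendPath p k z

    z-unmatched : ∀ b → isMatched (R b) z ≡ false
    z-unmatched true  = z-free
    z-unmatched false = trans (sym (agree-off-path z z-off)) z-free

    R′-apart : ∀ b {j} → j < k → outcome (R′ b) (p j) ≡ outcome (R b) (p j)
    R′-apart b j<k =
      addTo-outcome-apart (evenᵇ k) R b ac≐kz (λ eq → inner≢end j<k (sym eq)) (λ eq → z-off _ (<⇒≤ j<k) (sym eq))

    u-unmatched-without′ : isMatched (R′ false) u ≡ false
    u-unmatched-without′ with addTo-cases (evenᵇ k) (a , c) R false
    ... | inj₂ (_ , eq) rewrite eq = u-unmatched-without
    ... | inj₁ (false≡evenk , _) =
      trans (addTo-isMatched-apart (evenᵇ k) R false ac≐kz (end≢u (evenᵇ-false⇒0< (sym false≡evenk)))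
                                   (λ z≡u → z-off 0 z≤n (trans starts-at-u (sym z≡u))))
            u-unmatched-without

    new-edge-not-inner : ∀ {j} → j < k → ¬ SamePair a c (p j) (p (suc j))
    new-edge-not-inner {j} j<k ac≐j with SamePair-trans (SamePair-sym ac≐kz) ac≐j
    ... | inj₁ (_ , z≡p1+j) = z-off (suc j) j<k (sym z≡p1+j)
    ... | inj₂ (_ , z≡pj)   = z-off j (<⇒≤ j<k) (sym z≡pj)

    starts-at-u′ : p′ 0 ≡ u
    starts-at-u′ = trans (extendPath-≤ p k z z≤n) starts-at-u

    distinct′ : ∀ i j → i ≤ suc k → j ≤ suc k → p′ i ≡ p′ j → i ≡ j
    distinct′ i j i≤ j≤ eq with extendPath-split p k z i≤ | extendPath-split p k z j≤
    ... | inj₁ (i≤k , ei) | inj₁ (j≤k , ej) = distinct i j i≤k j≤k (trans (sym ei) (trans eq ej))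
    ... | inj₁ (i≤k , ei) | inj₂ (_ , ej)   = ⊥-elim (z-off i i≤k (trans (sym ei) (trans eq ej)))
    ... | inj₂ (_ , ei)   | inj₁ (j≤k , ej) = ⊥-elim (z-off j j≤k (trans (sym ej) (trans (sym eq) ei)))
    ... | inj₂ (i≡ , _)   | inj₂ (j≡ , _)   = trans i≡ (sym j≡)

    path-edge′ : ∀ j → j < suc k →
                 EdgeIn (R′ (evenᵇ j)) (p′ j) (p′ (suc j)) × ¬ EdgeIn (R′ (not (evenᵇ j))) (p′ j) (p′ (suc j))
    path-edge′ j (s≤s j≤k) with m≤n⇒m<n∨m≡n j≤k
    ... | inj₂ refl
      rewrite extendPath-≤ p k z (≤-refl {k}) | extendPath-new p k z
            | addTo-same (evenᵇ k) (a , c) R | addTo-other (evenᵇ k) (a , c) R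
      = EdgeIn-∷-here ac≐kz ,
        λ kz∈ → true≢false (trans (sym (EdgeIn⇒isMatchedʳ kz∈)) (z-unmatched (not (evenᵇ k))))
    ... | inj₁ j<k rewrite extendPath-≤ p k z (<⇒≤ j<k) | extendPath-≤ p k z j<k =
      addTo-EdgeIn⁺ (evenᵇ k) (a , c) R (evenᵇ j) (proj₁ (path-edge j j<k)) ,
      λ e → [ (λ { (_ , ac≐j) → new-edge-not-inner j<k ac≐j }) , proj₂ (path-edge j j<k) ]′
              (addTo-EdgeIn⁻ (evenᵇ k) R (not (evenᵇ j)) e)

    shared-or-on-path′ : ∀ b x w → EdgeIn (R′ b) x w →
                         EdgeIn (R′ (not b)) x w ⊎ ∃[ j ] (j < suc k × evenᵇ j ≡ b × SamePair (p′ j) (p′ (suc j)) x w)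
    shared-or-on-path′ b x w e with addTo-EdgeIn⁻ (evenᵇ k) R b e
    ... | inj₁ (refl , ac≐xw) =
      inj₂ (k , ≤-refl , refl ,
            subst₂ (λ s t → SamePair s t x w) (sym (extendPath-≤ p k z ≤-refl)) (sym (extendPath-new p k z))
                   (SamePair-trans (SamePair-sym ac≐kz) ac≐xw))
    ... | inj₂ old with shared-or-on-path b x w old
    ...   | inj₁ shared = inj₁ (addTo-EdgeIn⁺ (evenᵇ k) (a , c) R (not b) shared)
    ...   | inj₂ (j , j<k , evenj , j≐xw) =
      inj₂ (j , m<n⇒m<1+n j<k , evenj ,
            subst₂ (λ s t → SamePair s t x w) (sym (extendPath-≤ p k z (<⇒≤ j<k))) (sym (extendPath-≤ p k z j<k)) j≐xw)

    agree-off-path′ : ∀ v → OffPath p′ (suc k) v → isMatched (R′ true) v ≡ isMatched (R′ false) v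
    agree-off-path′ v off′ with OffPath-extend⁻ off′
    ... | off , z≢v =
      trans (addTo-isMatched-apart (evenᵇ k) R true ac≐kz (off k ≤-refl) z≢v)
            (trans (agree-off-path v off) (sym (addTo-isMatched-apart (evenᵇ k) R false ac≐kz (off k ≤-refl) z≢v)))

    end-unmatched′ : isMatched (R′ (evenᵇ (suc k))) (p′ (suc k)) ≡ false
    end-unmatched′ rewrite addTo-other (evenᵇ k) (a , c) R | extendPath-new p k z = z-unmatched (not (evenᵇ k))

    inner-improves′ : EndImproves R k p (a , c) →
                      ∀ j → 0 < j → j < suc k →
                      Better I y (outcome (R′ (not (evenᵇ j))) (p′ j)) (outcome (R′ (evenᵇ j)) (p′ j))
    inner-improves′ end-improves j 0<j (s≤s j≤k) with m≤n⇒m<n∨m≡n j≤k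
    ... | inj₂ refl
      rewrite extendPath-≤ p k z (≤-refl {k}) | addTo-same (evenᵇ k) (a , c) R | addTo-other (evenᵇ k) (a , c) R
      = end-improves 0<j
    ... | inj₁ j<k rewrite extendPath-≤ p k z (<⇒≤ j<k) | R′-apart (not (evenᵇ j)) j<k | R′-apart (evenᵇ j) j<k
      = inner-improves j 0<j j<k

    extended : EndImproves R k p (a , c) → AlternatingPath R′ (suc k) p′
    extended end-improves = record
      { u-unmatched-without = u-unmatched-without′
      ; starts-at-u         = starts-at-u′
      ; distinct            = distinct′
      ; path-edge           = path-edge′
      ; shared-or-on-path   = shared-or-on-path′
      ; agree-off-path      = agree-off-path′
      ; end-unmatched       = end-unmatched′
      ; inner-improves      = inner-improves′ end-improves
      }

  -- How the endpoint is matched in the run holding the last path edge, recorded so that any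
  -- later match in the other run is provably worse.
  EndOutcome : List (Event n) → (Bool → Matching n) → ℕ → (ℕ → Fin n) → Set
  EndOutcome xs R k p =
      (∃[ a ] (outcome (R (not (evenᵇ k))) (p k) ≡ passive a × deadline a ∈ xs))
    ⊎ (∃[ b ] (outcome (R (not (evenᵇ k))) (p k) ≡ active b ×
               (∀ c → adjOn (evenᵇ k) (p k) c ≡ true → isMatched (R (evenᵇ k)) c ≡ true)))

  Invariant : List (Event n) → (Bool → Matching n) → ℕ → (ℕ → Fin n) → Set
  Invariant xs R k p = AlternatingPath R k p × (0 < k → EndOutcome xs R k p)

  EndOutcome-++ : ∀ {xs R k p} ys → EndOutcome xs R k p → EndOutcome (xs ++ ys) R k p
  EndOutcome-++ ys (inj₁ (a , passive-a , a∈xs)) = inj₁ (a , passive-a , ∈-++⁺ˡ a∈xs)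
  EndOutcome-++ ys (inj₂ active-end)             = inj₂ active-end

  module AddShared {R k p} (path : AlternatingPath R k p) {w c} (w-off : OffPath p k w) (c-off : OffPath p k c) where
    open AlternatingPath path
    open AlternatingPathProperties path

    R′ : Bool → Matching n
    R′ b = (w , c) ∷ R b

    isMatched-on-path : ∀ b {j} → j ≤ k → isMatched (R′ b) (p j) ≡ isMatched (R b) (p j)
    isMatched-on-path b j≤k = isMatched-∷-apart {M = R b} (λ eq → w-off _ j≤k (sym eq)) (λ eq → c-off _ j≤k (sym eq))

    outcome-on-path : ∀ b {j} → j ≤ k → outcome (R′ b) (p j) ≡ outcome (R b) (p j)
    outcome-on-path b j≤k = outcome-∷-apart {M = R b} (λ eq → w-off _ j≤k (sym eq)) (λ eq → c-off _ j≤k (sym eq))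

    not-on-path : ∀ {j} → j < k → ¬ SamePair w c (p j) (p (suc j))
    not-on-path {j} j<k (inj₁ (w≡pj , _))   = w-off j (<⇒≤ j<k) (sym w≡pj)
    not-on-path {j} j<k (inj₂ (w≡p1+j , _)) = w-off (suc j) j<k (sym w≡p1+j)

    shared-or-on-path′ : ∀ b x z → EdgeIn (R′ b) x z →
                         EdgeIn (R′ (not b)) x z ⊎ ∃[ j ] (j < k × evenᵇ j ≡ b × SamePair (p j) (p (suc j)) x z)
    shared-or-on-path′ b x z e with EdgeIn-∷⁻ {M = R b} e
    ... | inj₁ wc≐xz = inj₁ (EdgeIn-∷-here wc≐xz)
    ... | inj₂ old with shared-or-on-path b x z old
    ...   | inj₁ other   = inj₁ (EdgeIn-∷⁺ (w , c) other)
    ...   | inj₂ on-path = inj₂ on-path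

    shared : AlternatingPath R′ k p
    shared = record
      { u-unmatched-without =
          trans (isMatched-∷-apart {M = R false} (off-path≢u w-off) (off-path≢u c-off)) u-unmatched-without
      ; starts-at-u = starts-at-u
      ; distinct = distinct
      ; path-edge = λ j j<k →
          EdgeIn-∷⁺ (w , c) (proj₁ (path-edge j j<k)) ,
          λ e → [ not-on-path j<k , proj₂ (path-edge j j<k) ]′ (EdgeIn-∷⁻ {M = R _} e)
      ; shared-or-on-path = shared-or-on-path′
      ; agree-off-path = λ v off → cong (λ t → (w =ᵇ v) ∨ ((c =ᵇ v) ∨ t)) (agree-off-path v off)
      ; end-unmatched = trans (isMatched-on-path (evenᵇ k) ≤-refl) end-unmatched
      ; inner-improves = λ j 0<j j<k →
          subst₂ (Better I y) (sym (outcome-on-path (not (evenᵇ j)) (<⇒≤ j<k))) (sym (outcome-on-path (evenᵇ j) (<⇒≤ j<k)))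
                 (inner-improves j 0<j j<k)
      }

    shared-end : ∀ {xs} → EndOutcome xs R k p → EndOutcome xs R′ k p
    shared-end (inj₁ (a , passive-a , a∈xs)) =
      inj₁ (a , trans (outcome-on-path (not (evenᵇ k)) ≤-refl) passive-a , a∈xs)
    shared-end (inj₂ (b , active-b , saturated)) =
      inj₂ (b , trans (outcome-on-path (not (evenᵇ k)) ≤-refl) active-b ,
            λ c′ adjacent → isMatched-∷⁺ {M = R (evenᵇ k)} w c (saturated c′ adjacent))

  StepResult : List (Event n) → (Bool → Matching n) → Event n → Set
  StepResult xs R e = ∃[ R′ ] ∃[ k′ ] ∃[ p′ ] (Invariant (xs ++ [ e ]) R′ k′ p′ × (∀ b → R′ b ≡ runStep b (R b) e))

  step-unchanged : ∀ {xs R k p} e → Invariant xs R k p → (∀ b → runStep b (R b) e ≡ R b) → StepResult xs R e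
  step-unchanged {R = R} {k} {p} e (path , end) no-change =
    R , k , p , (path , λ 0<k → EndOutcome-++ {R = R} {k} {p} [ e ] (end 0<k)) , λ b → sym (no-change b)

  step-matched : ∀ {xs R k p} w → Invariant xs R k p → w ≢ u → (∀ b → isMatched (R b) w ≡ true) →
                 StepResult xs R (deadline w)
  step-matched {R = R} w inv w≢u matched = step-unchanged (deadline w) inv λ b → runStep-matched b (R b) w≢u (matched b)

  module FirstDeadlineOfU {xs : List (Event n)} {R p} (path : AlternatingPath R 0 p) where
    open AlternatingPath path

    u-free : isMatched (R true) u ≡ false
    u-free = subst (λ v → isMatched (R true) v ≡ false) starts-at-u end-unmatched

    none : pickLeast (available true (R true) u) ≡ nothing → StepResult xs R (deadline u)
    none u-none = step-unchanged (deadline u) (path , λ ())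
      λ { true → rankingStep-none adj y (R true) u u-free u-none ; false → runStep-deadline-u (R false) }

    pick : ∀ c → pickLeast (available true (R true) u) ≡ just c → StepResult xs R (deadline u)
    pick c u-c = addTo true (u , c) R , 1 , extendPath p 0 c , (path′ , λ _ → end′) , agrees
      where
      c-available : available true (R true) u c ≡ true
      c-available = pickLeast-just (available true (R true) u) c u-c
      u≢c : u ≢ c
      u≢c = available⇒≢ true (R true) u c c-available
      c-off : OffPath p 0 c
      c-off .0 z≤n p0≡c = u≢c (trans (sym starts-at-u) p0≡c)
      path′ : AlternatingPath (addTo true (u , c) R) 1 (extendPath p 0 c)
      path′ = Extend.extended path (inj₁ (sym starts-at-u , refl)) c-off
                              (available⇒unmatched true (R true) u c c-available) (λ ())
      end′ : EndOutcome (xs ++ [ deadline u ]) (addTo true (u , c) R) 1 (extendPath p 0 c)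
      end′ rewrite extendPath-new p 0 c = inj₁ (u , outcome-∷-passive {M = R true} c u≢c , ∈-++⁺ʳ xs (here refl))
      agrees : ∀ b → addTo true (u , c) R b ≡ runStep b (R b) (deadline u)
      agrees true  = sym (rankingStep-pick adj y (R true) u c u-free u-c)
      agrees false = sym (runStep-deadline-u (R false))

    result : StepResult xs R (deadline u)
    result with pickLeast (available true (R true) u) in u-pick
    ... | nothing = none u-pick
    ... | just c  = pick c u-pick

  step-u-later : ∀ {xs R k p} → Invariant xs R k p → 0 < k → StepResult xs R (deadline u)
  step-u-later {R = R} inv 0<k = step-unchanged (deadline u) inv
    λ { true → rankingStep-matched adj y (R true) u (AlternatingPathProperties.u-matched-with (proj₁ inv) 0<k)
      ; false → runStep-deadline-u (R false) }

  module EndDeadline {xs R k p} (inv : Invariant xs R k p) (pk≢u : p k ≢ u) where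
    open AlternatingPath (proj₁ inv)
    open AlternatingPathProperties (proj₁ inv)

    path : AlternatingPath R k p
    path = proj₁ inv

    s : Bool
    s = evenᵇ k

    0<k : 0 < k
    0<k = end≢u⇒0< path pk≢u

    far-stays : runStep (not s) (R (not s)) (deadline (p k)) ≡ R (not s)
    far-stays = runStep-matched (not s) (R (not s)) pk≢u (end-matched-other path 0<k)

    none : pickLeast (available s (R s) (p k)) ≡ nothing → StepResult xs R (deadline (p k))
    none near-none = step-unchanged (deadline (p k)) inv stays
      where
      stays : ∀ b → runStep b (R b) (deadline (p k)) ≡ R b
      stays b with ≡-or-≡not b s
      ... | inj₁ refl = runStep-none s (R s) pk≢u end-unmatched near-none
      ... | inj₂ refl = far-stays

    pick : ∀ c → pickLeast (available s (R s) (p k)) ≡ just c → StepResult xs R (deadline (p k))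
    pick c near-c = R′ , suc k , extendPath p k c , (path′ , λ _ → end′) , agrees
      where
      R′ : Bool → Matching n
      R′ = addTo s (p k , c) R
      c-available : available s (R s) (p k) c ≡ true
      c-available = pickLeast-just _ c near-c
      c-off : OffPath p k c
      c-off j j≤k pj≡c with m≤n⇒m<n∨m≡n j≤k
      ... | inj₁ j<k  = available⇒not-inner s (p k) c-available j<k pj≡c
      ... | inj₂ refl = available⇒≢ s (R s) (p k) c c-available pj≡c
      c-free : isMatched (R true) c ≡ false
      c-free = unmatched-off-path c-off s (available⇒unmatched s (R s) (p k) c c-available) true
      end-improves : EndImproves R k p (p k , c)
      end-improves 0<k rewrite outcome-∷-active {M = R s} (p k) c with proj₂ inv 0<k
      ... | inj₁ (_ , passive-a , _) rewrite passive-a = pas>act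
      ... | inj₂ (_ , _ , saturated) =
        ⊥-elim (true≢false (trans (sym (saturated c (available⇒adj s (R s) (p k) c c-available)))
                                  (available⇒unmatched s (R s) (p k) c c-available)))
      path′ : AlternatingPath R′ (suc k) (extendPath p k c)
      path′ = Extend.extended path (inj₁ (refl , refl)) c-off c-free end-improves
      end′ : EndOutcome (xs ++ [ deadline (p k) ]) R′ (suc k) (extendPath p k c)
      end′ rewrite extendPath-new p k c | not-involutive s | addTo-same s (p k , c) R =
        inj₁ (p k , outcome-∷-passive {M = R s} c (c-off k ≤-refl) , ∈-++⁺ʳ xs (here refl))
      agrees : ∀ b → R′ b ≡ runStep b (R b) (deadline (p k))
      agrees b with ≡-or-≡not b s
      ... | inj₁ refl = trans (addTo-same s (p k , c) R) (sym (runStep-pick s (R s) c pk≢u end-unmatched near-c))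
      ... | inj₂ refl = trans (addTo-other s (p k , c) R) (sym far-stays)

    result : StepResult xs R (deadline (p k))
    result with pickLeast (available s (R s) (p k)) in near-pick
    ... | nothing = none near-pick
    ... | just c  = pick c near-pick

  Before-deadline : ∀ {a w xs zs} → deadline a ∈ xs → events ≡ xs ++ (deadline w ∷ zs) →
                    Before (deadline a) (deadline w) events
  Before-deadline {a} {w} {xs} {zs} a∈xs split with ∈-∃++ a∈xs
  ... | ys , ys′ , refl = ys , ys′ , zs , trans split (++-assoc ys (deadline a ∷ ys′) (deadline w ∷ zs))

  module OffPathDeadline {xs zs R k p} w (split : events ≡ xs ++ (deadline w ∷ zs)) (inv : Invariant xs R k p)
                         (w-off : OffPath p k w) (w-free : ∀ b → isMatched (R b) w ≡ false) where
    open AlternatingPath (proj₁ inv)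
    open AlternatingPathProperties (proj₁ inv)

    path : AlternatingPath R k p
    path = proj₁ inv

    end : 0 < k → EndOutcome xs R k p
    end = proj₂ inv

    s : Bool
    s = evenᵇ k

    w≢u : w ≢ u
    w≢u = off-path≢u w-off

    -- The endpoint p k is free on the near side s.
    near far : Fin n → Bool
    near = available s (R s) w
    far  = available (not s) (R (not s)) w

    far-end : far (p k) ≡ false
    far-end = end-unavailable-other path w

    far-off-path : ∀ c → far c ≡ true → OffPath p k c
    far-off-path c avail j j≤k pj≡c with m≤n⇒m<n∨m≡n j≤k
    ... | inj₁ j<k  = available⇒not-inner (not s) w avail j<k pj≡c
    ... | inj₂ refl = true≢false (trans (sym avail) (subst (λ v → far v ≡ false) pj≡c far-end))

    far⊆near : ∀ c → far c ≡ true → near c ≡ true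
    far⊆near c avail = trans (available-off-path w-off (far-off-path c avail) s (not s)) avail

    near⊆far∪end : ∀ c → near c ≡ true → c ≢ p k → far c ≡ true
    near⊆far∪end c avail c≢pk with locate p k c
    ... | inj₂ c-off = trans (available-off-path w-off c-off (not s) s) avail
    ... | inj₁ (j , j≤k , pj≡c) with m≤n⇒m<n∨m≡n j≤k
    ...   | inj₁ j<k  = ⊥-elim (available⇒not-inner s w avail j<k pj≡c)
    ...   | inj₂ refl = ⊥-elim (c≢pk (sym pj≡c))

    runs-none : ∀ {b} → pickLeast (available b (R b) w) ≡ nothing → runStep b (R b) (deadline w) ≡ R b
    runs-none {b} none = runStep-none b (R b) w≢u (w-free b) none

    runs-pick : ∀ {b} c → pickLeast (available b (R b) w) ≡ just c → runStep b (R b) (deadline w) ≡ (w , c) ∷ R b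
    runs-pick {b} c picked = runStep-pick b (R b) c w≢u (w-free b) picked

    both-none : pickLeast far ≡ nothing → pickLeast near ≡ nothing → StepResult xs R (deadline w)
    both-none far-none near-none = step-unchanged (deadline w) inv stays
      where
      stays : ∀ b → runStep b (R b) (deadline w) ≡ R b
      stays b with ≡-or-≡not b s
      ... | inj₁ refl = runs-none near-none
      ... | inj₂ refl = runs-none far-none

    both-pick : ∀ c → pickLeast far ≡ just c → pickLeast near ≡ just c → StepResult xs R (deadline w)
    both-pick c far-c near-c = R′ , k , p , (shared , λ 0<k → shared-end (EndOutcome-++ {R = R} {k} {p} [ deadline w ] (end 0<k))) ,
                               agrees
      where
      c-off : OffPath p k c
      c-off = far-off-path c (pickLeast-just far c far-c)
      open AddShared path w-off c-off
      agrees : ∀ b → (w , c) ∷ R b ≡ runStep b (R b) (deadline w)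
      agrees b with ≡-or-≡not b s
      ... | inj₁ refl = sym (runs-pick c near-c)
      ... | inj₂ refl = sym (runs-pick c far-c)

    module TakeEnd (near-end : pickLeast near ≡ just (p k)) where
      R₁ : Bool → Matching n
      R₁ = addTo s (w , p k) R

      p₁ : ℕ → Fin n
      p₁ = extendPath p k w

      pk≢w : p k ≢ w
      pk≢w = w-off k ≤-refl

      end-improves : EndImproves R k p (w , p k)
      end-improves 0<k rewrite outcome-∷-passive {M = R s} (p k) (λ w≡pk → pk≢w (sym w≡pk)) with end 0<k
      ... | inj₁ (a , passive-a , a∈xs) rewrite passive-a = pas>pas (Before-deadline a∈xs split)
      ... | inj₂ (_ , _ , saturated) = ⊥-elim (true≢false (trans (sym (saturated w pk~w)) (w-free s)))
        where
        pk~w : adjOn s (p k) w ≡ true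
        pk~w = trans (adjOn-sym s (p k) w) (available⇒adj s (R s) w (p k) (pickLeast-just near (p k) near-end))

      path₁ : AlternatingPath R₁ (suc k) p₁
      path₁ = Extend.extended path (inj₂ (refl , refl)) w-off (w-free true) end-improves

      agrees-near : R₁ s ≡ runStep s (R s) (deadline w)
      agrees-near = trans (addTo-same s (w , p k) R) (sym (runs-pick (p k) near-end))

    only-near : pickLeast near ≡ just (p k) → pickLeast far ≡ nothing → StepResult xs R (deadline w)
    only-near near-end far-none = R₁ , suc k , p₁ , (path₁ , λ _ → end′) , agrees
      where
      open TakeEnd near-end
      end′ : EndOutcome (xs ++ [ deadline w ]) R₁ (suc k) p₁
      end′ rewrite extendPath-new p k w | not-involutive s | addTo-same s (w , p k) R | addTo-other s (w , p k) R =
        inj₂ (p k , outcome-∷-active {M = R s} w (p k) ,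
              λ c adjacent → unavailable-neighbour-matched (not s) (R (not s)) w c (pickLeast-nothing far far-none c) adjacent)
      agrees : ∀ b → R₁ b ≡ runStep b (R b) (deadline w)
      agrees b with ≡-or-≡not b s
      ... | inj₁ refl = agrees-near
      ... | inj₂ refl = trans (addTo-other s (w , p k) R) (sym (runs-none far-none))

    near-beats-far : ∀ c → pickLeast near ≡ just (p k) → pickLeast far ≡ just c → y (p k) < y c →
                     StepResult xs R (deadline w)
    near-beats-far c near-end far-c pk<c = R₂ , suc (suc k) , p₂ , (path₂ , λ _ → end′) , agrees
      where
      open TakeEnd near-end
      c-available : far c ≡ true
      c-available = pickLeast-just far c far-c
      c-off : OffPath p k c
      c-off = far-off-path c c-available
      w≢c : w ≢ c
      w≢c = available⇒≢ (not s) (R (not s)) w c c-available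
      c-free₁ : isMatched (R₁ true) c ≡ false
      c-free₁ = trans (addTo-isMatched-apart s R true (inj₂ (refl , refl)) (c-off k ≤-refl) w≢c)
                      (unmatched-off-path c-off (not s) (available⇒unmatched (not s) (R (not s)) w c c-available) true)
      w-improves : EndImproves R₁ (suc k) p₁ (w , c)
      w-improves _ rewrite extendPath-new p k w | not-involutive s | addTo-same s (w , p k) R | addTo-other s (w , p k) R
                         | outcome-∷-active {M = R s} w (p k) | outcome-∷-active {M = R (not s)} w c = act>act pk<c
      R₂ : Bool → Matching n
      R₂ = addTo (not s) (w , c) R₁
      p₂ : ℕ → Fin n
      p₂ = extendPath p₁ (suc k) c
      path₂ : AlternatingPath R₂ (suc (suc k)) p₂
      path₂ = Extend.extended path₁ (inj₁ (sym (extendPath-new p k w) , refl)) (OffPath-extend c-off w≢c) c-free₁ w-improves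
      end′ : EndOutcome (xs ++ [ deadline w ]) R₂ (suc (suc k)) p₂
      end′ rewrite extendPath-new p₁ (suc k) c | not-involutive (not s) | addTo-same (not s) (w , c) R₁ =
        inj₁ (w , outcome-∷-passive {M = R₁ (not s)} c w≢c , ∈-++⁺ʳ xs (here refl))
      agrees : ∀ b → R₂ b ≡ runStep b (R b) (deadline w)
      agrees b with ≡-or-≡not b s
      ... | inj₁ refl = trans (addTo-not s (w , c) R₁) agrees-near
      ... | inj₂ refl = trans (addTo-same (not s) (w , c) R₁)
                              (trans (cong ((w , c) ∷_) (addTo-other s (w , p k) R)) (sym (runs-pick c far-c)))

    result : StepResult xs R (deadline w)
    result with pickLeast-without y-injective far near (p k) far⊆near near⊆far∪end far-end
    ... | only-x near-end far-none          = only-near near-end far-none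
    ... | x-beats c near-end far-c pk<c      = near-beats-far c near-end far-c pk<c
    ... | unchanged same with pickLeast near in near-pick
    ...   | nothing = both-none same near-pick
    ...   | just c  = both-pick c same near-pick

  step-u : ∀ {xs R k p} → Invariant xs R k p → StepResult xs R (deadline u)
  step-u {k = zero}  (path , _) = FirstDeadlineOfU.result path
  step-u {k = suc _} inv        = step-u-later inv (s≤s z≤n)

  step : ∀ {R k p} xs e zs → events ≡ xs ++ (e ∷ zs) → Invariant xs R k p → StepResult xs R e
  step {R} xs (arrive v) zs split inv = step-unchanged (arrive v) inv λ b → runStep-arrive b (R b) v
  step {R} {k} {p} xs (deadline w) zs split inv with w Fin.≟ u
  ... | yes refl = step-u inv
  ... | no w≢u with locate p k w
  ...   | inj₁ (j , j≤k , refl) with m≤n⇒m<n∨m≡n j≤k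
  ...     | inj₂ refl = EndDeadline.result inv w≢u
  ...     | inj₁ j<k  = step-matched (p j) inv w≢u (matched-inner j (≢u⇒0< j w≢u) j<k)
    where open AlternatingPathProperties (proj₁ inv)
  step {R} {k} {p} xs (deadline w) zs split inv | no w≢u | inj₂ w-off with isMatched (R true) w in w-matched
  ...   | true  = step-matched w inv w≢u
                    λ { true → w-matched ; false → trans (sym (AlternatingPath.agree-off-path (proj₁ inv) w w-off)) w-matched }
  ...   | false = OffPathDeadline.result w split inv w-off
                    (AlternatingPathProperties.unmatched-off-path (proj₁ inv) w-off true w-matched)

  RunsTo : List (Event n) → (Bool → Matching n) → Set
  RunsTo zs R = ∃[ R′ ] ∃[ k ] ∃[ p ] (Invariant events R′ k p ×
                R′ true  ≡ foldl (rankingStep adj y) (R true) zs ×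
                R′ false ≡ foldl (rankingStep (adjWithout adj u) y) (R false) (eventsWithout zs u))

  run : ∀ {R k p} xs zs → events ≡ xs ++ zs → Invariant xs R k p → RunsTo zs R
  run {R} {k} {p} xs [] split inv =
    R , k , p , subst (λ es → Invariant es R k p) (sym (trans split (++-identityʳ xs))) inv , refl , refl
  run {R} xs (e ∷ zs) split inv with step xs e zs split inv
  ... | R₁ , _ , _ , inv₁ , agrees with run (xs ++ [ e ]) zs (trans split (sym (++-assoc xs [ e ] zs))) inv₁
  ...   | R′ , k′ , p′ , inv′ , with-u , without-u =
    R′ , k′ , p′ , inv′ ,
    trans with-u (cong (λ M → foldl (rankingStep adj y) M zs) (agrees true)) ,
    trans without-u (trans (cong (λ M → foldl (rankingStep (adjWithout adj u) y) M (eventsWithout zs u)) (agrees false))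
                           (runs-without-u (R false) e zs))

  initial : Invariant [] (λ _ → []) 0 (λ _ → u)
  initial = record
    { u-unmatched-without = refl
    ; starts-at-u = refl
    ; distinct = λ { .0 .0 z≤n z≤n _ → refl }
    ; path-edge = λ _ ()
    ; shared-or-on-path = λ { _ _ _ (inj₁ ()) ; _ _ _ (inj₂ ()) }
    ; agree-off-path = λ _ _ → refl
    ; end-unmatched = refl
    ; inner-improves = λ _ _ ()
    } , λ ()

  AlternatingSymDiff : Matching n → Matching n → Set
  AlternatingSymDiff M M′ = ∃[ l ] ∃[ q ] (Injective _≡_ _≡_ q × q zero ≡ u
    × (∀ a b → SymDiff M M′ a b → ∃[ i ] PathEdgeAt q i a b)
    × (∀ i a b → PathEdgeAt q i a b → SymDiff M M′ a b)
    × (∀ (i : Fin l) → IsEven (toℕ i) → EdgeIn M (q (inject₁ i)) (q (fsuc i)))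
    × (∀ (i : Fin l) → IsOdd (toℕ i) → EdgeIn M′ (q (inject₁ i)) (q (fsuc i)))
    × (∀ (j : Fin (suc l)) → IsOdd (toℕ j) → Better I y (outcome M (q j)) (outcome M′ (q j)))
    × (∀ (j : Fin (suc l)) → IsEven (toℕ j) → j ≢ zero → Better I y (outcome M′ (q j)) (outcome M (q j))))

  SymDiff-side : ∀ {R : Bool → Matching n} b {x z} → EdgeIn (R b) x z → ¬ EdgeIn (R (not b)) x z →
                 SymDiff (R true) (R false) x z
  SymDiff-side true  e ¬e = inj₁ (e , ¬e)
  SymDiff-side false e ¬e = inj₂ (e , ¬e)

  module Final {R k p} (inv : Invariant events R k p) where
    open AlternatingPath (proj₁ inv)

    q : Fin (suc k) → Fin n
    q i = p (toℕ i)

    q-injective : Injective _≡_ _≡_ q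
    q-injective {i} {j} qi≡qj = Fin.toℕ-injective (distinct _ _ (≤-pred (Fin.toℕ<n i)) (≤-pred (Fin.toℕ<n j)) qi≡qj)

    path-edge-at : ∀ {j a c} (j<k : j < k) → SamePair (p j) (p (suc j)) a c → PathEdgeAt q (fromℕ< j<k) a c
    path-edge-at j<k j≐ac rewrite Fin.toℕ-inject₁ (fromℕ< j<k) | Fin.toℕ-fromℕ< j<k = j≐ac

    path-edge-at⁻ : ∀ (i : Fin k) {a c} → PathEdgeAt q i a c → SamePair (p (toℕ i)) (p (suc (toℕ i))) a c
    path-edge-at⁻ i i≐ac rewrite Fin.toℕ-inject₁ i = i≐ac

    q-edge : ∀ (i : Fin k) → EdgeIn (R (evenᵇ (toℕ i))) (q (inject₁ i)) (q (fsuc i))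
    q-edge i rewrite Fin.toℕ-inject₁ i = proj₁ (path-edge (toℕ i) (Fin.toℕ<n i))

    only-on-path : ∀ b {a c} → EdgeIn (R b) a c → ¬ EdgeIn (R (not b)) a c → ∃[ i ] PathEdgeAt q i a c
    only-on-path b {a} {c} e ¬e with shared-or-on-path b a c e
    ... | inj₁ other                  = ⊥-elim (¬e other)
    ... | inj₂ (j , j<k , _ , j≐ac) = fromℕ< j<k , path-edge-at j<k j≐ac

    symDiff⇒path : ∀ a c → SymDiff (R true) (R false) a c → ∃[ i ] PathEdgeAt q i a c
    symDiff⇒path a c (inj₁ (e , ¬e)) = only-on-path true e ¬e
    symDiff⇒path a c (inj₂ (e , ¬e)) = only-on-path false e ¬e

    path⇒symDiff : ∀ i a c → PathEdgeAt q i a c → SymDiff (R true) (R false) a c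
    path⇒symDiff i a c i≐ac with path-edge (toℕ i) (Fin.toℕ<n i)
    ... | on-side , ¬other-side =
      SymDiff-side {R} (evenᵇ (toℕ i)) (EdgeIn-SamePair i≐ac′ on-side)
                   (λ e → ¬other-side (EdgeIn-SamePair (SamePair-sym i≐ac′) e))
      where
      i≐ac′ : SamePair (p (toℕ i)) (p (suc (toℕ i))) a c
      i≐ac′ = path-edge-at⁻ i i≐ac

    even-edge : ∀ (i : Fin k) → IsEven (toℕ i) → EdgeIn (R true) (q (inject₁ i)) (q (fsuc i))
    even-edge i even = subst (λ b → EdgeIn (R b) (q (inject₁ i)) (q (fsuc i))) (IsEven⇒evenᵇ (toℕ i) even) (q-edge i)

    odd-edge : ∀ (i : Fin k) → IsOdd (toℕ i) → EdgeIn (R false) (q (inject₁ i)) (q (fsuc i))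
    odd-edge i odd = subst (λ b → EdgeIn (R b) (q (inject₁ i)) (q (fsuc i))) (IsOdd⇒evenᵇ (toℕ i) odd) (q-edge i)

    improves : ∀ j → j ≤ k → 0 < j → Better I y (outcome (R (not (evenᵇ j))) (p j)) (outcome (R (evenᵇ j)) (p j))
    improves j j≤k 0<j with m≤n⇒m<n∨m≡n j≤k
    ... | inj₁ j<k = inner-improves j 0<j j<k
    ... | inj₂ refl rewrite outcome-unmatched (R (evenᵇ j)) (p j) end-unmatched with proj₂ inv 0<j
    ...   | inj₁ (_ , passive-a , _) rewrite passive-a = pas>un
    ...   | inj₂ (_ , active-b  , _) rewrite active-b  = act>un

    q-improves : ∀ (j : Fin (suc k)) b → evenᵇ (toℕ j) ≡ b → 0 < toℕ j →
                 Better I y (outcome (R (not b)) (q j)) (outcome (R b) (q j))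
    q-improves j _ refl = improves (toℕ j) (≤-pred (Fin.toℕ<n j))

    odd-improves : ∀ (j : Fin (suc k)) → IsOdd (toℕ j) → Better I y (outcome (R true) (q j)) (outcome (R false) (q j))
    odd-improves j odd = q-improves j false (IsOdd⇒evenᵇ (toℕ j) odd) (IsOdd⇒0< (toℕ j) odd)

    even-improves : ∀ (j : Fin (suc k)) → IsEven (toℕ j) → j ≢ zero →
                    Better I y (outcome (R false) (q j)) (outcome (R true) (q j))
    even-improves zero     _    j≢0 = ⊥-elim (j≢0 refl)
    even-improves (fsuc j) even _   = q-improves (fsuc j) true (IsEven⇒evenᵇ (toℕ (fsuc j)) even) (s≤s z≤n)

    alternating : AlternatingSymDiff (R true) (R false)
    alternating = k , q , q-injective , starts-at-u , symDiff⇒path , path⇒symDiff , even-edge , odd-edge ,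
                  odd-improves , even-improves

  theorem : AlternatingSymDiff (ranking I y) (rankingWithout I y u)
  theorem with run [] events refl initial
  ... | R , _ , _ , inv , with-u , without-u = subst₂ AlternatingSymDiff with-u without-u (Final.alternating inv)

lemma3 : ∀ {n} (I : Instance n) (y : Fin n → ℕ) → Injective _≡_ _≡_ y →
  (u : Fin n) → IsMatched (ranking I y) u →
  ∃[ l ] ∃[ p ] (Injective _≡_ _≡_ p × p zero ≡ u
    × (∀ a b → SymDiff (ranking I y) (rankingWithout I y u) a b → ∃[ i ] PathEdgeAt p i a b)
    × (∀ i a b → PathEdgeAt p i a b → SymDiff (ranking I y) (rankingWithout I y u) a b)
    × (∀ (i : Fin l) → IsEven (toℕ i) → EdgeIn (ranking I y) (p (inject₁ i)) (p (fsuc i)))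
    × (∀ (i : Fin l) → IsOdd (toℕ i) → EdgeIn (rankingWithout I y u) (p (inject₁ i)) (p (fsuc i)))
    × (∀ (j : Fin (suc l)) → IsOdd (toℕ j) →
        Better I y (outcome (ranking I y) (p j)) (outcome (rankingWithout I y u) (p j)))
    × (∀ (j : Fin (suc l)) → IsEven (toℕ j) → j ≢ zero →
        Better I y (outcome (rankingWithout I y u) (p j)) (outcome (ranking I y) (p j))))
lemma3 I y y-injective u _ = TwoRuns.theorem I y y-injective u
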